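{- Let $k\geq1$ and let $X=\{a_1,\dots,a_k\}$ be a set of nonzero integers with $|a_1|<|a_2|<\cdots<|a_k|$. Let $\mathfrak{R}_X$ be the set of permutations of $X$ ending with $a_1$. Then \[ \sum_{\pi\in\mathfrak{R}_X}t^{\mathrm{des}_B(\pi)}=\begin{cases}1,& k=1\text{ and }a_1>0,\\ t,& k=1\text{ and }a_1<0,\\ tA_{k-1}(t),& k\geq2.\end{cases} \]
   Context: $A_m(t)=\sum_{\pi}t^{\mathrm{des}(\pi)}$, summing over all permutations $\pi$ of $[m]$, where $\mathrm{des}(\pi)=|\{r\in[m-1]:\pi_r>\pi_{r+1}\}|$. For a signed permutation $\sigma=\sigma_1\cdots\sigma_k$ of $[k]$, with $\sigma_0=0$, $\mathrm{des}_B(\sigma)=|\{r\in\{0,\dots,k-1\}:\sigma_r>\sigma_{r+1}\}|$. For a set $Y$ of nonzero integers with distinct absolute values, the reduction $\mathrm{red}$ replaces the entry with the $r$-th smallest absolute value by $r$ or $-r$ according to its sign; for a permutation $\pi$ of $Y$, $\mathrm{red}(\pi)$ is obtained entrywise, and $\mathrm{des}_B(\pi):=\mathrm{des}_B(\mathrm{red}(\pi))$. -}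

module Defs where

open import Data.Bool using (Bool; true; false; if_then_else_)
open import Data.Nat as ℕ using (ℕ; zero; suc)
open import Data.Integer as ℤ using (ℤ; +_; -_; ∣_∣; _*_; _+_)
open import Data.List using (List; []; _∷_; _++_; map; concatMap; foldr; upTo; length)
open import Relation.Nullary.Decidable using (⌊_⌋)

insertions : {A : Set} → A → List A → List (List A)
insertions x []       = (x ∷ []) ∷ []
insertions x (y ∷ ys) = (x ∷ y ∷ ys) ∷ map (y ∷_) (insertions x ys)

-- All permutations (arrangements) of a list; for a list of distinct
-- elements this enumerates each permutation exactly once.
perms : {A : Set} → List A → List (List A)
perms []       = [] ∷ []
perms (x ∷ xs) = concatMap (insertions x) (perms xs)

filterB : {A : Set} → (A → Bool) → List A → List A
filterB p []       = []
filterB p (x ∷ xs) = if p x then x ∷ filterB p xs else filterB p xs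

endsWith : ℤ → List ℤ → Bool
endsWith a []           = false
endsWith a (x ∷ [])     = ⌊ x ℤ.≟ a ⌋
endsWith a (x ∷ y ∷ ys) = endsWith a (y ∷ ys)

sumℤ : List ℤ → ℤ
sumℤ = foldr _+_ (+ 0)

descents : List ℤ → ℕ
descents []           = 0
descents (x ∷ [])     = 0
descents (x ∷ y ∷ ys) =
  (if ⌊ y ℤ.<? x ⌋ then 1 else 0) ℕ.+ descents (y ∷ ys)

des : List ℕ → ℕ
des π = descents (map +_ π)

permsOf[_] : ℕ → List (List ℕ)
permsOf[ m ] = perms (map suc (upTo m))

eulerian : ℕ → ℤ → ℤ
eulerian m t = sumℤ (map (λ π → t ℤ.^ des π) permsOf[ m ])

countSmaller : ℤ → List ℤ → ℕ
countSmaller x []       = 0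
countSmaller x (y ∷ ys) =
  (if ⌊ ∣ y ∣ ℕ.<? ∣ x ∣ ⌋ then 1 else 0) ℕ.+ countSmaller x ys

signedRank : ℤ → ℕ → ℤ
signedRank x r = if ⌊ x ℤ.<? + 0 ⌋ then - (+ r) else + r

red : List ℤ → List ℤ
red π = map (λ x → signedRank x (suc (countSmaller x π))) π

-- Type B descent number, with σ₀ = 0 prepended; des_B(π) = des_B(red π).
desB : List ℤ → ℕ
desB π = descents (+ 0 ∷ red π)

-- ℜ_X : permutations of X ending with a₁ (X listed as a₁ ∷ as).
ℜ : ℤ → List ℤ → List (List ℤ)
ℜ a₁ as = filterB (endsWith a₁) (perms (a₁ ∷ as))

ℜsum : ℤ → List ℤ → ℤ → ℤ
ℜsum a₁ as t = sumℤ (map (λ π → t ℤ.^ desB π) (ℜ a₁ as))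

-- Red is strictly increasing on the entries of π and keeps their signs, so des_B π = des(0π).
-- For π = σa₁ with σ nonempty, a₁ has the smallest absolute value and hence compares with every
-- entry of σ exactly as 0 does, so des_B(σa₁) = des(0σ0). Build σ by inserting one entry at a
-- time: whatever the values, inserting a new entry into the gaps of 0σ0 keeps d = des(0σ0) in
-- exactly d of them and raises it by one in the others. Hence Σ_σ t^des(0σ0) depends only on the
-- number n of entries, and for the entries 1, …, n it equals Σ_π t^(des π + 1) = t A_n(t).
{-# OPTIONS --safe #-}
module Submission where

open import Defs
open import Data.Nat using (ℕ; suc; _≤_)
open import Data.Integer using (ℤ; +_; _*_; _<_; ∣_∣)
open import Data.List using (List; []; _∷_; length)
open import Data.List.Relation.Unary.All using (All)
open import Data.List.Relation.Unary.Linked using (Linked)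
open import Data.Product using (_×_)
open import Relation.Binary.PropositionalEquality using (_≡_; _≢_)

open import Data.Bool using (Bool; true; false; if_then_else_)
open import Data.Empty using (⊥-elim)
open import Data.Nat as ℕ using (zero; z≤n; s≤s)
import Data.Nat.Properties as ℕ
open import Data.Integer as ℤ using (-[1+_]; _+_; _-_; _^_; _<?_; -<-; -<+; +<+)
import Data.Integer.Properties as ℤ
open import Data.Integer.Tactic.RingSolver using (solve-∀)
open import Data.List using (_++_; _∷ʳ_; [_]; map; concat; concatMap; upTo)
open import Data.List.Properties
  using (map-∘; map-++; map-cong; map-cong-local; map-concatMap; concatMap-map; concatMap-pure;
         length-map; length-upTo)
open import Data.List.Membership.Propositional using (_∈_)
open import Data.List.Relation.Unary.Any using (here; there)
open import Data.List.Relation.Unary.All using ([]; _∷_)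
import Data.List.Relation.Unary.All as All
import Data.List.Relation.Unary.All.Properties as All
open import Data.List.Relation.Unary.AllPairs using (AllPairs; _∷_)
import Data.List.Relation.Unary.AllPairs as AllPairs
import Data.List.Relation.Unary.Linked.Properties as Linked
import Data.List.Relation.Unary.Unique.Propositional.Properties as Unique
open import Data.List.Relation.Binary.Permutation.Propositional
  using (_↭_; ↭-refl; ↭-prep; ↭-swap; ↭-trans; ↭-sym)
open import Data.List.Relation.Binary.Permutation.Propositional.Properties using (All-resp-↭; ↭-length)
open import Data.Product using (∃-syntax; _,_)
open import Function.Base using (_∘_)
open import Function.Bundles using (_⇔_; mk⇔; Equivalence)
open import Relation.Binary.Definitions using (tri<; tri≈; tri>)
open import Relation.Binary.PropositionalEquality using (refl; sym; trans; cong; cong₂; subst; module ≡-Reasoning)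
open import Relation.Nullary using (¬_; yes; no)
open import Relation.Nullary.Decidable using (⌊_⌋)

open ≡-Reasoning

-- Lists: sums, filters and permutations

sumℤ-++ : ∀ xs ys → sumℤ (xs ++ ys) ≡ sumℤ xs + sumℤ ys
sumℤ-++ []       ys = sym (ℤ.+-identityˡ (sumℤ ys))
sumℤ-++ (x ∷ xs) ys = trans (cong (_+_ x) (sumℤ-++ xs ys)) (sym (ℤ.+-assoc x (sumℤ xs) (sumℤ ys)))

sumℤ-concatMap : ∀ {A B : Set} (F : B → ℤ) (h : A → List B) xs →
                 sumℤ (map F (concatMap h xs)) ≡ sumℤ (map (λ x → sumℤ (map F (h x))) xs)
sumℤ-concatMap F h []       = refl
sumℤ-concatMap F h (x ∷ xs) = begin
  sumℤ (map F (h x ++ concatMap h xs))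
    ≡⟨ cong sumℤ (map-++ F (h x) (concatMap h xs)) ⟩
  sumℤ (map F (h x) ++ map F (concatMap h xs))
    ≡⟨ sumℤ-++ (map F (h x)) (map F (concatMap h xs)) ⟩
  sumℤ (map F (h x)) + sumℤ (map F (concatMap h xs))
    ≡⟨ cong (_+_ (sumℤ (map F (h x)))) (sumℤ-concatMap F h xs) ⟩
  sumℤ (map F (h x)) + sumℤ (map (λ x → sumℤ (map F (h x))) xs)
    ∎

sumℤ-*ˡ : ∀ {A : Set} t (F : A → ℤ) xs → t * sumℤ (map F xs) ≡ sumℤ (map (λ x → t * F x) xs)
sumℤ-*ˡ t F []       = ℤ.*-zeroʳ t
sumℤ-*ˡ t F (x ∷ xs) =
  trans (ℤ.*-distribˡ-+ t (F x) (sumℤ (map F xs))) (cong (_+_ (t * F x)) (sumℤ-*ˡ t F xs))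

filterB-++ : ∀ {A : Set} (p : A → Bool) xs ys → filterB p (xs ++ ys) ≡ filterB p xs ++ filterB p ys
filterB-++ p []       ys = refl
filterB-++ p (x ∷ xs) ys with p x
... | true  = cong (x ∷_) (filterB-++ p xs ys)
... | false = filterB-++ p xs ys

filterB-concatMap : ∀ {A B : Set} (p : B → Bool) (h : A → List B) xs →
                    filterB p (concatMap h xs) ≡ concatMap (filterB p ∘ h) xs
filterB-concatMap p h []       = refl
filterB-concatMap p h (x ∷ xs) =
  trans (filterB-++ p (h x) (concatMap h xs)) (cong (filterB p (h x) ++_) (filterB-concatMap p h xs))

filterB-map : ∀ {A B : Set} {p : B → Bool} {q : A → Bool} (g : A → B) xs →
              All (λ x → p (g x) ≡ q x) xs → filterB p (map g xs) ≡ map g (filterB q xs)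
filterB-map g []       []         = refl
filterB-map {q = q} g (x ∷ xs) (eq ∷ eqs) rewrite eq with q x
... | true  = cong (g x ∷_) (filterB-map g xs eqs)
... | false = filterB-map g xs eqs

insertions-↭ : ∀ {A : Set} (x : A) xs → All (_↭ x ∷ xs) (insertions x xs)
insertions-↭ x []       = ↭-refl ∷ []
insertions-↭ x (y ∷ ys) =
  ↭-refl ∷ All.map⁺ (All.map (λ τ↭ → ↭-trans (↭-prep y τ↭) (↭-swap y x ↭-refl)) (insertions-↭ x ys))

perms-↭ : ∀ {A : Set} (xs : List A) → All (_↭ xs) (perms xs)
perms-↭ []       = ↭-refl ∷ []
perms-↭ (x ∷ xs) = All.concat⁺ (All.map⁺ (All.map insert (perms-↭ xs)))
  where
  insert : ∀ {σ} → σ ↭ xs → All (_↭ x ∷ xs) (insertions x σ)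
  insert σ↭xs = All.map (λ τ↭ → ↭-trans τ↭ (↭-prep x σ↭xs)) (insertions-↭ x _)

map-insertions : ∀ {A B : Set} (g : A → B) x xs →
                 map (map g) (insertions x xs) ≡ insertions (g x) (map g xs)
map-insertions g x []       = refl
map-insertions g x (y ∷ ys) = cong ((g x ∷ g y ∷ map g ys) ∷_) (begin
  map (map g) (map (y ∷_) (insertions x ys))     ≡⟨ map-∘ (insertions x ys) ⟨
  map (λ τ → g y ∷ map g τ) (insertions x ys)    ≡⟨ map-∘ (insertions x ys) ⟩
  map (g y ∷_) (map (map g) (insertions x ys))   ≡⟨ cong (map (g y ∷_)) (map-insertions g x ys) ⟩
  map (g y ∷_) (insertions (g x) (map g ys))     ∎)

map-perms : ∀ {A B : Set} (g : A → B) xs → map (map g) (perms xs) ≡ perms (map g xs)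
map-perms g []       = refl
map-perms g (x ∷ xs) = begin
  map (map g) (concatMap (insertions x) (perms xs))
    ≡⟨ map-concatMap (map g) (insertions x) (perms xs) ⟩
  concatMap (λ σ → map (map g) (insertions x σ)) (perms xs)
    ≡⟨ cong concat (map-cong (map-insertions g x) (perms xs)) ⟩
  concatMap (λ σ → insertions (g x) (map g σ)) (perms xs)
    ≡⟨ concatMap-map (insertions (g x)) (map g) (perms xs) ⟨
  concatMap (insertions (g x)) (map (map g) (perms xs))
    ≡⟨ cong (concatMap (insertions (g x))) (map-perms g xs) ⟩
  concatMap (insertions (g x)) (perms (map g xs))
    ∎

-- Descents

-- descents (x ∷ y ∷ ys) reduces to descentAt x y ℕ.+ descents (y ∷ ys).
descentAt : ℤ → ℤ → ℕ
descentAt x y = if ⌊ y <? x ⌋ then 1 else 0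

descentAt-< : ∀ {x y} → y < x → descentAt x y ≡ 1
descentAt-< {x} {y} y<x with y <? x
... | yes _   = refl
... | no y≮x = ⊥-elim (y≮x y<x)

descentAt-≮ : ∀ {x y} → ¬ y < x → descentAt x y ≡ 0
descentAt-≮ {x} {y} y≮x with y <? x
... | yes y<x = ⊥-elim (y≮x y<x)
... | no _    = refl

descentAt-cong : ∀ {x y x′ y′} → y < x ⇔ y′ < x′ → descentAt x y ≡ descentAt x′ y′
descentAt-cong {x} {y} {x′} {y′} y<x⇔y′<x′ with y <? x | y′ <? x′
... | yes _   | yes _    = refl
... | no _    | no _     = refl
... | yes y<x | no y′≮x′ = ⊥-elim (y′≮x′ (Equivalence.to y<x⇔y′<x′ y<x))
... | no y≮x  | yes y′<x′ = ⊥-elim (y≮x (Equivalence.from y<x⇔y′<x′ y′<x′))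

descentAt-flip : ∀ {x y} → x ≢ y → descentAt x y ℕ.+ descentAt y x ≡ 1
descentAt-flip {x} {y} x≢y with y <? x | x <? y
... | yes y<x | yes x<y = ⊥-elim (ℤ.<-asym y<x x<y)
... | yes _   | no _    = refl
... | no _    | yes _   = refl
... | no y≮x  | no x≮y  = ⊥-elim (x≢y (ℤ.≤-antisym (ℤ.≮⇒≥ y≮x) (ℤ.≮⇒≥ x≮y)))

descentAt-insert : ∀ u x v → ∃[ δ ] δ ≤ 1 × descentAt u x ℕ.+ descentAt x v ≡ δ ℕ.+ descentAt u v
descentAt-insert u x v with x <? u | v <? x | v <? u
... | yes _   | yes _   | yes _   = 1 , s≤s z≤n , refl
... | yes x<u | yes v<x | no v≮u  = ⊥-elim (v≮u (ℤ.<-trans v<x x<u))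
... | yes _   | no _    | yes _   = 0 , z≤n , refl
... | yes _   | no _    | no _    = 1 , s≤s z≤n , refl
... | no _    | yes _   | yes _   = 0 , z≤n , refl
... | no _    | yes _   | no _    = 1 , s≤s z≤n , refl
... | no x≮u  | no v≮x  | yes v<u =
  ⊥-elim (ℤ.<-irrefl refl (ℤ.<-≤-trans v<u (ℤ.≤-trans (ℤ.≮⇒≥ x≮u) (ℤ.≮⇒≥ v≮x))))
... | no _    | no _    | no _    = 0 , z≤n , refl

descentsBetween : ℤ → List ℤ → ℤ → ℕ
descentsBetween a σ e = descents (a ∷ (σ ∷ʳ e))

closedDescents : List ℤ → ℕ
closedDescents σ = descentsBetween (+ 0) σ (+ 0)

strictMono⇒⇔ : ∀ {P : ℤ → Set} (G : ℤ → ℤ) → (∀ {y z} → P y → P z → z < y → G z < G y) →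
               ∀ {y z} → P y → P z → G z < G y ⇔ z < y
strictMono⇒⇔ G mono {y} {z} py pz = mk⇔ reflect (mono py pz)
  where
  reflect : G z < G y → z < y
  reflect Gz<Gy with ℤ.<-cmp z y
  ... | tri< z<y _ _    = z<y
  ... | tri≈ _ refl _   = ⊥-elim (ℤ.<-irrefl refl Gz<Gy)
  ... | tri> _ _ y<z    = ⊥-elim (ℤ.<-asym Gz<Gy (mono pz py y<z))

descents-map : ∀ {P : ℤ → Set} (G : ℤ → ℤ) {c d} xs → All P xs →
               (∀ {z} → P z → G z < c ⇔ z < d) →
               (∀ {y z} → P y → P z → z < y → G z < G y) →
               descents (c ∷ map G xs) ≡ descents (d ∷ xs)
descents-map G []       []         head mono = refl
descents-map G (y ∷ ys) (py ∷ pys) head mono =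
  cong₂ ℕ._+_ (descentAt-cong (head py))
              (descents-map G ys pys (λ pz → strictMono⇒⇔ G mono py pz) mono)

descents-∷ʳ-cong : ∀ {e e′} s σ → All (λ y → e < y ⇔ e′ < y) (s ∷ σ) →
                   descents (s ∷ (σ ∷ʳ e)) ≡ descents (s ∷ (σ ∷ʳ e′))
descents-∷ʳ-cong s []      (e<s⇔e′<s ∷ []) = cong (ℕ._+ 0) (descentAt-cong e<s⇔e′<s)
descents-∷ʳ-cong s (t ∷ σ) (_ ∷ rest)      = cong (descentAt s t ℕ.+_) (descents-∷ʳ-cong t σ rest)

descents-∷ʳ-0 : ∀ s σ → All (+ 0 <_) (s ∷ σ) → descents (s ∷ (σ ∷ʳ + 0)) ≡ suc (descents (s ∷ σ))
descents-∷ʳ-0 s []       (0<s ∷ [])  = cong (ℕ._+ 0) (descentAt-< 0<s)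
descents-∷ʳ-0 s (t ∷ σ) (_ ∷ 0<σ) =
  trans (cong (descentAt s t ℕ.+_) (descents-∷ʳ-0 t σ 0<σ)) (ℕ.+-suc (descentAt s t) (descents (t ∷ σ)))

closedDescents-positive : ∀ σ → All (+ 0 <_) σ → 1 ≤ length σ → closedDescents σ ≡ suc (descents σ)
closedDescents-positive (s ∷ σ) 0<σ@(0<s ∷ _) _ =
  cong₂ ℕ._+_ (descentAt-≮ (ℤ.<-asym 0<s)) (descents-∷ʳ-0 s σ 0<σ)

-- Inserting a new entry

-- Σ f over n insertion positions, K of which keep the descent number D while the others
-- raise it to D + 1.
gapSum : ℕ → ℤ → ℕ → (ℕ → ℤ) → ℤ
gapSum D K n f = K * f D + (+ n - K) * f (suc D)

gapSum-insert : ∀ {δ} → δ ≤ 1 → ∀ D K n f →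
                f (δ ℕ.+ D) + gapSum D K n f ≡ gapSum D (K + + 1 - + δ) (suc n) f
gapSum-insert z≤n       D K n f = keep K (+ n) (f D) (f (suc D))
  where
  keep : ∀ K N F₀ F₁ →
         F₀ + (K * F₀ + (N - K) * F₁) ≡ (K + + 1 - + 0) * F₀ + (+ 1 + N - (K + + 1 - + 0)) * F₁
  keep = solve-∀
gapSum-insert (s≤s z≤n) D K n f = raise K (+ n) (f D) (f (suc D))
  where
  raise : ∀ K N F₀ F₁ →
          F₁ + (K * F₀ + (N - K) * F₁) ≡ (K + + 1 - + 1) * F₀ + (+ 1 + N - (K + + 1 - + 1)) * F₁
  raise = solve-∀

gapSum-shift : ∀ r D K n f → gapSum D K n (λ d → f (r ℕ.+ d)) ≡ gapSum (r ℕ.+ D) K n f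
gapSum-shift r D K n f = cong (λ d → K * f (r ℕ.+ D) + (+ n - K) * f d) (ℕ.+-suc r D)

+-assoc-cong : ∀ p q δ r B → p ℕ.+ q ≡ δ ℕ.+ r → p ℕ.+ (q ℕ.+ B) ≡ δ ℕ.+ (r ℕ.+ B)
+-assoc-cong p q δ r B eq =
  trans (sym (ℕ.+-assoc p q B)) (trans (cong (ℕ._+ B) eq) (ℕ.+-assoc δ r B))

gapCount-base : ∀ {d} δ D → d ≡ δ ℕ.+ D → + suc D - + d ≡ + 0 + + 1 - + δ
gapCount-base δ D refl = trans (cong (λ v → + suc D - v) (ℤ.pos-+ δ D)) (identity (+ δ) (+ D))
  where
  identity : ∀ Δ D → + 1 + D - (Δ + D) ≡ + 0 + + 1 - Δ
  identity = solve-∀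

gapCount-step : ∀ {p q r s δ} B c → p ℕ.+ q ≡ δ ℕ.+ r → q ℕ.+ s ≡ 1 →
                + suc (r ℕ.+ B) - + (p ℕ.+ c) ≡ + suc B - + (s ℕ.+ c) + + 1 - + δ
gapCount-step {p} {q} {r} {s} {δ} B c pq≡δr qs≡1 = begin
  + 1 + + (r ℕ.+ B) - + (p ℕ.+ c)
    ≡⟨ cong₂ (λ u v → + 1 + u - v) (ℤ.pos-+ r B) (ℤ.pos-+ p c) ⟩
  + 1 + (+ r + + B) - (+ p + + c)
    ≡⟨ rearrange (+ p) (+ q) (+ r) (+ s) (+ δ) (+ B) (+ c) ⟩
  K′ + ((+ δ + + r) - (+ p + + q)) + ((+ q + + s) - + 1)
    ≡⟨ cong₂ (λ u v → K′ + (u - (+ p + + q)) + (v - + 1)) (sym pq≡δrℤ) qs≡1ℤ ⟩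
  K′ + ((+ p + + q) - (+ p + + q)) + (+ 1 - + 1)
    ≡⟨ cancel K′ (+ p + + q) ⟩
  K′
    ≡⟨ cong (λ v → + 1 + + B - v + + 1 - + δ) (sym (ℤ.pos-+ s c)) ⟩
  + suc B - + (s ℕ.+ c) + + 1 - + δ
    ∎
  where
  K′ : ℤ
  K′ = + 1 + + B - (+ s + + c) + + 1 - + δ
  pq≡δrℤ : + p + + q ≡ + δ + + r
  pq≡δrℤ = trans (sym (ℤ.pos-+ p q)) (trans (cong +_ pq≡δr) (ℤ.pos-+ δ r))
  qs≡1ℤ : + q + + s ≡ + 1
  qs≡1ℤ = trans (sym (ℤ.pos-+ q s)) (cong +_ qs≡1)
  rearrange : ∀ P Q R S Δ B C → + 1 + (R + B) - (P + C)
              ≡ (+ 1 + B - (S + C) + + 1 - Δ) + ((Δ + R) - (P + Q)) + ((Q + S) - + 1)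
  rearrange = solve-∀
  cancel : ∀ K X → K + (X - X) + (+ 1 - + 1) ≡ K
  cancel = solve-∀

sum-insertions : ∀ (f : ℕ → ℤ) a x e σ → All (x ≢_) σ →
  sumℤ (map (λ τ → f (descentsBetween a τ e)) (insertions x σ))
  ≡ gapSum (descentsBetween a σ e)
           (+ suc (descentsBetween a σ e) - + descentsBetween a (x ∷ []) e)
           (suc (length σ)) f
sum-insertions f a x e [] [] with descentAt-insert a x e
... | δ , δ≤1 , between = begin
  f d₀ + + 0
    ≡⟨ cong (λ d → f d + + 0) d₀≡δ+D ⟩
  f (δ ℕ.+ D) + gapSum D (+ 0) 0 f
    ≡⟨ gapSum-insert δ≤1 D (+ 0) 0 f ⟩
  gapSum D (+ 0 + + 1 - + δ) 1 f
    ≡⟨ cong (λ K → gapSum D K 1 f) (sym (gapCount-base δ D d₀≡δ+D)) ⟩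
  gapSum D (+ suc D - + d₀) 1 f
    ∎
  where
  D d₀ : ℕ
  D  = descentsBetween a [] e
  d₀ = descentsBetween a (x ∷ []) e
  d₀≡δ+D : d₀ ≡ δ ℕ.+ D
  d₀≡δ+D = +-assoc-cong (descentAt a x) (descentAt x e) δ (descentAt a e) 0 between
sum-insertions f a x e (y ∷ ys) (x≢y ∷ x∉ys) with descentAt-insert a x y
... | δ , δ≤1 , between = begin
  f (p ℕ.+ (q ℕ.+ B)) + sumℤ (map F (map (y ∷_) (insertions x ys)))
    ≡⟨ cong₂ _+_ (cong f (+-assoc-cong p q δ r B between)) later-insertions ⟩
  f (δ ℕ.+ (r ℕ.+ B)) + gapSum B K′ (suc m) (λ d → f (r ℕ.+ d))
    ≡⟨ cong (_+_ (f (δ ℕ.+ (r ℕ.+ B)))) (gapSum-shift r B K′ (suc m) f) ⟩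
  f (δ ℕ.+ (r ℕ.+ B)) + gapSum (r ℕ.+ B) K′ (suc m) f
    ≡⟨ gapSum-insert δ≤1 (r ℕ.+ B) K′ (suc m) f ⟩
  gapSum (r ℕ.+ B) (K′ + + 1 - + δ) (suc (suc m)) f
    ≡⟨ cong (λ K → gapSum (r ℕ.+ B) K (suc (suc m)) f) (sym count) ⟩
  gapSum (r ℕ.+ B) (+ suc (r ℕ.+ B) - + (p ℕ.+ c)) (suc (suc m)) f
    ∎
  where
  F : List ℤ → ℤ
  F τ = f (descentsBetween a τ e)
  p q r c B m : ℕ
  p = descentAt a x
  q = descentAt x y
  r = descentAt a y
  c = descentAt x e ℕ.+ 0
  B = descentsBetween y ys e
  m = length ys
  K′ : ℤ
  K′ = + suc B - + descentsBetween y (x ∷ []) e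
  later-insertions : sumℤ (map F (map (y ∷_) (insertions x ys))) ≡ gapSum B K′ (suc m) (λ d → f (r ℕ.+ d))
  later-insertions = trans (cong sumℤ (sym (map-∘ (insertions x ys))))
                           (sum-insertions (λ d → f (r ℕ.+ d)) y x e ys x∉ys)
  count : + suc (r ℕ.+ B) - + (p ℕ.+ c) ≡ K′ + + 1 - + δ
  count = gapCount-step {p} {q} {r} {δ = δ} B c between (descentAt-flip x≢y)

-- Inserting a new entry into the n + 1 gaps of 0σ0, where des(0σ0) = d, keeps d descents in d of
-- the gaps and gives d + 1 in the others.
closedDescentSum : ℕ → (ℕ → ℤ) → ℤ
closedDescentSum zero    f = f 0
closedDescentSum (suc n) f = closedDescentSum n (λ d → gapSum d (+ d) (suc n) f)

sum-perms-closedDescents : ∀ (f : ℕ → ℤ) S → All (_≢ + 0) S → AllPairs _≢_ S →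
  sumℤ (map (f ∘ closedDescents) (perms S)) ≡ closedDescentSum (length S) f
sum-perms-closedDescents f []       _              _                   = ℤ.+-identityʳ (f 0)
sum-perms-closedDescents f (x ∷ xs) (x≢0 ∷ xs≢0) (x∉xs ∷ xs-distinct) = begin
  sumℤ (map (f ∘ closedDescents) (concatMap (insertions x) (perms xs)))
    ≡⟨ sumℤ-concatMap (f ∘ closedDescents) (insertions x) (perms xs) ⟩
  sumℤ (map (λ σ → sumℤ (map (f ∘ closedDescents) (insertions x σ))) (perms xs))
    ≡⟨ cong sumℤ (map-cong-local (All.map insert (perms-↭ xs))) ⟩
  sumℤ (map (g ∘ closedDescents) (perms xs))
    ≡⟨ sum-perms-closedDescents g xs xs≢0 xs-distinct ⟩
  closedDescentSum (length xs) g
    ∎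
  where
  g : ℕ → ℤ
  g d = gapSum d (+ d) (suc (length xs)) f
  insert : ∀ {σ} → σ ↭ xs → sumℤ (map (f ∘ closedDescents) (insertions x σ)) ≡ g (closedDescents σ)
  insert {σ} σ↭xs = trans (sum-insertions f (+ 0) x (+ 0) σ (All-resp-↭ (↭-sym σ↭xs) x∉xs))
    (cong₂ (λ d n → gapSum D (+ suc D - + d) (suc n) f)
           (trans (cong (descentAt (+ 0) x ℕ.+_) (ℕ.+-identityʳ _)) (descentAt-flip (x≢0 ∘ sym)))
           (↭-length σ↭xs))
    where
    D : ℕ
    D = closedDescents σ

eulerian-closedDescentSum : ∀ n t → 1 ≤ n → t * eulerian n t ≡ closedDescentSum n (t ^_)
eulerian-closedDescentSum n t 1≤n = begin
  t * sumℤ (map (λ π → t ^ des π) (perms [n]))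
    ≡⟨ sumℤ-*ˡ t (λ π → t ^ des π) (perms [n]) ⟩
  sumℤ (map (λ π → t ^ suc (descents (map (+_) π))) (perms [n]))
    ≡⟨ cong sumℤ (map-∘ (perms [n])) ⟩
  sumℤ (map (λ σ → t ^ suc (descents σ)) (map (map (+_)) (perms [n])))
    ≡⟨ cong (sumℤ ∘ map (λ σ → t ^ suc (descents σ))) (map-perms (+_) [n]) ⟩
  sumℤ (map (λ σ → t ^ suc (descents σ)) (perms S))
    ≡⟨ cong sumℤ (map-cong-local (All.map close (perms-↭ S))) ⟩
  sumℤ (map ((t ^_) ∘ closedDescents) (perms S))
    ≡⟨ sum-perms-closedDescents (t ^_) S (All.map (λ 0<s → ℤ.<⇒≢ 0<s ∘ sym) positive) distinct ⟩
  closedDescentSum (length S) (t ^_)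
    ≡⟨ cong (λ m → closedDescentSum m (t ^_)) length-S ⟩
  closedDescentSum n (t ^_)
    ∎
  where
  [n] : List ℕ
  [n] = map suc (upTo n)
  S : List ℤ
  S = map (+_) [n]
  length-S : length S ≡ n
  length-S = trans (length-map (+_) [n]) (trans (length-map suc (upTo n)) (length-upTo n))
  positive : All (+ 0 <_) S
  positive = All.map⁺ (All.map⁺ (All.universal (λ _ → +<+ (s≤s z≤n)) (upTo n)))
  distinct : AllPairs _≢_ S
  distinct = Unique.map⁺ ℤ.+-injective (Unique.map⁺ ℕ.suc-injective (Unique.upTo⁺ n))
  close : ∀ {σ} → σ ↭ S → t ^ suc (descents σ) ≡ t ^ closedDescents σ
  close {σ} σ↭S = cong (t ^_) (sym (closedDescents-positive σ (All-resp-↭ (↭-sym σ↭S) positive)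
                                      (subst (1 ≤_) (sym (trans (↭-length σ↭S) length-S)) 1≤n)))

-- The reduction red

<-indicator-mono : ∀ k {m n} → m ≤ n → (if ⌊ k ℕ.<? m ⌋ then 1 else 0) ≤ (if ⌊ k ℕ.<? n ⌋ then 1 else 0)
<-indicator-mono k {m} {n} m≤n with k ℕ.<? m | k ℕ.<? n
... | yes _   | yes _  = ℕ.≤-refl
... | yes k<m | no k≮n = ⊥-elim (k≮n (ℕ.<-≤-trans k<m m≤n))
... | no _    | _      = z≤n

countSmaller-mono-≤ : ∀ {z y} M → ∣ z ∣ ≤ ∣ y ∣ → countSmaller z M ≤ countSmaller y M
countSmaller-mono-≤ []      _   = z≤n
countSmaller-mono-≤ (w ∷ M) z≤y = ℕ.+-mono-≤ (<-indicator-mono ∣ w ∣ z≤y) (countSmaller-mono-≤ M z≤y)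

countSmaller-mono-< : ∀ {z y M} → z ∈ M → ∣ z ∣ ℕ.< ∣ y ∣ → countSmaller z M ℕ.< countSmaller y M
countSmaller-mono-< {z} {y} {z ∷ M} (here refl) z<y with ∣ z ∣ ℕ.<? ∣ z ∣ | ∣ z ∣ ℕ.<? ∣ y ∣
... | yes z<z | _      = ⊥-elim (ℕ.<-irrefl refl z<z)
... | no _    | no z≮y = ⊥-elim (z≮y z<y)
... | no _    | yes _  = s≤s (countSmaller-mono-≤ M (ℕ.<⇒≤ z<y))
countSmaller-mono-< {z} {y} {w ∷ M} (there z∈M) z<y =
  ℕ.+-mono-≤-< (<-indicator-mono ∣ w ∣ (ℕ.<⇒≤ z<y)) (countSmaller-mono-< z∈M z<y)

rank : List ℤ → ℤ → ℤ
rank π x = signedRank x (suc (countSmaller x π))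

rank-sign : ∀ π z → rank π z < + 0 ⇔ z < + 0
rank-sign π -[1+ m ] = mk⇔ (λ _ → -<+) (λ _ → -<+)
rank-sign π (+ m)    = mk⇔ (λ { (+<+ ()) }) (λ { (+<+ ()) })

rank-mono : ∀ π {y z} → y ∈ π → z ∈ π → z < y → rank π z < rank π y
rank-mono π y∈π _   (-<- n<m) = -<- (countSmaller-mono-< y∈π (s≤s n<m))
rank-mono π _   _   -<+       = -<+
rank-mono π _   z∈π (+<+ m<n) = +<+ (s≤s (countSmaller-mono-< z∈π m<n))

desB≡descents : ∀ π → desB π ≡ descents (+ 0 ∷ π)
desB≡descents π =
  descents-map (rank π) π (All.tabulate (λ x∈π → x∈π)) (λ {z} _ → rank-sign π z) (rank-mono π)

smallerAbs-<⇔ : ∀ {a s} → ∣ a ∣ ℕ.< ∣ s ∣ → a < s ⇔ + 0 < s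
smallerAbs-<⇔ {+ k}      {+ m}      k<m = mk⇔ (λ _ → +<+ (ℕ.≤-<-trans z≤n k<m)) (λ _ → +<+ k<m)
smallerAbs-<⇔ { -[1+ k ]} {+ m}      k<m = mk⇔ (λ _ → +<+ (ℕ.≤-<-trans z≤n k<m)) (λ _ → -<+)
smallerAbs-<⇔ {+ k}      { -[1+ m ]} _   = mk⇔ (λ ()) (λ ())
smallerAbs-<⇔ { -[1+ k ]} { -[1+ m ]} (s≤s k<m) = mk⇔ (λ { (-<- m<k) → ⊥-elim (ℕ.<-asym m<k k<m) }) (λ ())

desB-∷ʳ : ∀ a σ → 1 ≤ length σ → All (λ s → ∣ a ∣ ℕ.< ∣ s ∣) σ → desB (σ ∷ʳ a) ≡ closedDescents σ
desB-∷ʳ a (s ∷ σ) _ a-smallest = trans (desB≡descents ((s ∷ σ) ∷ʳ a))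
  (cong (descentAt (+ 0) s ℕ.+_) (descents-∷ʳ-cong s σ (All.map smallerAbs-<⇔ a-smallest)))

-- Permutations ending with a₁

endsWith-∷-insertions : ∀ a y x σ → All (λ τ → endsWith a (y ∷ τ) ≡ endsWith a τ) (insertions x σ)
endsWith-∷-insertions a y x []       = refl ∷ []
endsWith-∷-insertions a y x (z ∷ zs) = refl ∷ All.map⁺ (All.universal (λ _ → refl) (insertions x zs))

endsWith-≢ : ∀ {a} y ys → All (_≢ a) (y ∷ ys) → endsWith a (y ∷ ys) ≡ false
endsWith-≢ {a} y []       (y≢a ∷ []) with y ℤ.≟ a
... | yes y≡a = ⊥-elim (y≢a y≡a)
... | no _    = refl
endsWith-≢ y (z ∷ zs) (_ ∷ rest) = endsWith-≢ z zs rest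

filterB-endsWith-insertions : ∀ a σ → All (_≢ a) σ → filterB (endsWith a) (insertions a σ) ≡ (σ ∷ʳ a) ∷ []
filterB-endsWith-insertions a []       [] with a ℤ.≟ a
... | yes _   = refl
... | no a≢a = ⊥-elim (a≢a refl)
filterB-endsWith-insertions a (y ∷ ys) σ≢a@(_ ∷ ys≢a) rewrite endsWith-≢ y ys σ≢a = begin
  filterB (endsWith a) (map (y ∷_) (insertions a ys))
    ≡⟨ filterB-map (y ∷_) (insertions a ys) (endsWith-∷-insertions a y a ys) ⟩
  map (y ∷_) (filterB (endsWith a) (insertions a ys))
    ≡⟨ cong (map (y ∷_)) (filterB-endsWith-insertions a ys ys≢a) ⟩
  ((y ∷ ys) ∷ʳ a) ∷ []
    ∎

ℜ-perms : ∀ a as → All (_≢ a) as → ℜ a as ≡ map (_∷ʳ a) (perms as)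
ℜ-perms a as as≢a = begin
  filterB (endsWith a) (concatMap (insertions a) (perms as))
    ≡⟨ filterB-concatMap (endsWith a) (insertions a) (perms as) ⟩
  concatMap (filterB (endsWith a) ∘ insertions a) (perms as)
    ≡⟨ cong concat (map-cong-local (All.map single (perms-↭ as))) ⟩
  concatMap (λ σ → (σ ∷ʳ a) ∷ []) (perms as)
    ≡⟨ concatMap-map [_] (_∷ʳ a) (perms as) ⟨
  concatMap [_] (map (_∷ʳ a) (perms as))
    ≡⟨ concatMap-pure (map (_∷ʳ a) (perms as)) ⟩
  map (_∷ʳ a) (perms as)
    ∎
  where
  single : ∀ {σ} → σ ↭ as → filterB (endsWith a) (insertions a σ) ≡ (σ ∷ʳ a) ∷ []
  single {σ} σ↭as = filterB-endsWith-insertions a σ (All-resp-↭ (↭-sym σ↭as) as≢a)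

ℜsum-perms : ∀ a as t → All (_≢ a) as → ℜsum a as t ≡ sumℤ (map (λ σ → t ^ desB (σ ∷ʳ a)) (perms as))
ℜsum-perms a as t as≢a =
  trans (cong (sumℤ ∘ map (λ π → t ^ desB π)) (ℜ-perms a as as≢a)) (cong sumℤ (sym (map-∘ (perms as))))

ℜsum-singleton : ∀ a t → ℜsum a [] t ≡ t ^ descentAt (+ 0) a
ℜsum-singleton a t = begin
  ℜsum a [] t              ≡⟨ ℜsum-perms a [] t [] ⟩
  t ^ desB (a ∷ []) + + 0  ≡⟨ ℤ.+-identityʳ _ ⟩
  t ^ desB (a ∷ [])        ≡⟨ cong (t ^_) (trans (desB≡descents (a ∷ [])) (ℕ.+-identityʳ _)) ⟩
  t ^ descentAt (+ 0) a    ∎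

ℜsum≡t*eulerian : ∀ a as t → All (_≢ + 0) as → AllPairs (λ a b → ∣ a ∣ ℕ.< ∣ b ∣) (a ∷ as) →
                  1 ≤ length as → ℜsum a as t ≡ t * eulerian (length as) t
ℜsum≡t*eulerian a as t as≢0 (a-smallest ∷ abs-increasing) 1≤k = begin
  ℜsum a as t
    ≡⟨ ℜsum-perms a as t (All.map (λ a<s → distinct a<s ∘ sym) a-smallest) ⟩
  sumℤ (map (λ σ → t ^ desB (σ ∷ʳ a)) (perms as))
    ≡⟨ cong sumℤ (map-cong-local (All.map close (perms-↭ as))) ⟩
  sumℤ (map ((t ^_) ∘ closedDescents) (perms as))
    ≡⟨ sum-perms-closedDescents (t ^_) as as≢0 (AllPairs.map distinct abs-increasing) ⟩
  closedDescentSum (length as) (t ^_)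
    ≡⟨ eulerian-closedDescentSum (length as) t 1≤k ⟨
  t * eulerian (length as) t
    ∎
  where
  distinct : ∀ {a b} → ∣ a ∣ ℕ.< ∣ b ∣ → a ≢ b
  distinct |a|<|b| refl = ℕ.<-irrefl refl |a|<|b|
  close : ∀ {σ} → σ ↭ as → t ^ desB (σ ∷ʳ a) ≡ t ^ closedDescents σ
  close {σ} σ↭as = cong (t ^_) (desB-∷ʳ a σ (subst (1 ≤_) (sym (↭-length σ↭as)) 1≤k)
                                            (All-resp-↭ (↭-sym σ↭as) a-smallest))

lemma2p5 : (a₁ : ℤ) (as : List ℤ)
    → All (λ a → a ≢ + 0) (a₁ ∷ as)
    → Linked (λ a b → Data.Nat._<_ ∣ a ∣ ∣ b ∣) (a₁ ∷ as)
    → (t : ℤ)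
    → (as ≡ [] → + 0 < a₁ → ℜsum a₁ as t ≡ + 1)
      × (as ≡ [] → a₁ < + 0 → ℜsum a₁ as t ≡ t)
      × (1 ≤ length as → ℜsum a₁ as t ≡ t * eulerian (length as) t)
lemma2p5 a₁ as (_ ∷ as≢0) increasing t = single-positive , single-negative , several
  where
  single-positive : as ≡ [] → + 0 < a₁ → ℜsum a₁ as t ≡ + 1
  single-positive refl 0<a₁ = trans (ℜsum-singleton a₁ t) (cong (t ^_) (descentAt-≮ (ℤ.<-asym 0<a₁)))

  single-negative : as ≡ [] → a₁ < + 0 → ℜsum a₁ as t ≡ t
  single-negative refl a₁<0 =
    trans (ℜsum-singleton a₁ t) (trans (cong (t ^_) (descentAt-< a₁<0)) (ℤ.^-identityʳ t))

  several : 1 ≤ length as → ℜsum a₁ as t ≡ t * eulerian (length as) t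
  several = ℜsum≡t*eulerian a₁ as t as≢0 (Linked.Linked⇒AllPairs ℕ.<-trans increasing)
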